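{- Let $w=\begin{pmatrix}0&0&1\\1&0&0\\0&1&0\end{pmatrix}$. Then \[ BwB\cap\mathrm{SL}_3(\mathbb{Z})=\bigcup_{\substack{(d_1,d_2)\in\mathbb{Z}^2\\ d_1d_2\neq0}}\Omega_w(d_1,d_1d_2), \] and for every $A\in\Omega_w(d_1,d_1d_2)$ there exist $u,u'\in\Gamma_\infty$ and matrices $\gamma_1=\begin{pmatrix}x_1&b_1\\d_1&y_1\end{pmatrix},\gamma_2=\begin{pmatrix}x_2&b_2\\d_2&y_2\end{pmatrix}\in\mathrm{SL}_2(\mathbb{Z})$ such that $uAu'=\iota_\alpha(\gamma_1)\iota_\beta(\gamma_2)$. Finally, for every positive integer $N$, \[ BwB\cap\Gamma_0(N)=\bigcup_{\substack{d_1,d_2\in\mathbb{Z}\\ N\mid d_2,\ d_1d_2\neq0}}\Omega_w(d_1,d_1d_2). \]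
   Context: $B$ is the group of upper triangular matrices in $\mathrm{SL}_3(\mathbb{R})$; $U_3(\mathbb{R})$ the group of upper triangular unipotent $3\times3$ real matrices; $\Gamma_\infty=U_3(\mathbb{Z})$. For nonzero reals $c_1,c_2$, $t(c_1,c_2)=\mathrm{diag}(c_1,c_2/c_1,1/c_2)$ and $\Omega_w(c_1,c_2)=\{u_Lwt(c_1,c_2)u_R\in\mathrm{SL}_3(\mathbb{Z}):u_L,u_R\in U_3(\mathbb{R})\}$. For $\gamma=\begin{pmatrix}a&b\\c&d\end{pmatrix}$, $\iota_\alpha(\gamma)=\begin{pmatrix}a&b&0\\c&d&0\\0&0&1\end{pmatrix}$ and $\iota_\beta(\gamma)=\begin{pmatrix}1&0&0\\0&a&b\\0&c&d\end{pmatrix}$. $\Gamma_0(N)=\{A\in\mathrm{SL}_3(\mathbb{Z}):A_{31}\equiv A_{32}\equiv0\pmod N\}$. -}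

module Defs where

open import Level using (Level; _⊔_) renaming (suc to lsuc)
open import Data.Nat using (ℕ; zero; suc)
open import Data.Integer as ℤ using (ℤ; +_; -[1+_])
open import Data.Fin using (Fin; toℕ) renaming (zero to f0)
open import Data.Fin.Patterns using (0F; 1F; 2F)
import Data.Nat as ℕ
open import Data.Product using (Σ; ∃; _×_; _,_)
open import Relation.Nullary using (¬_)
open import Relation.Binary.Core using (Rel)
open import Relation.Binary.Structures using (IsTotalOrder)
open import Relation.Binary.PropositionalEquality using (_≡_)
open import Data.Integer.Divisibility using (_∣_)
open import Algebra.Bundles using (CommutativeRing)

-- The real numbers, axiomatised as a complete ordered field
-- (agda-stdlib has no reals).  Inverse is total with 0⁻¹ = 0.

record RealField (c ℓ : Level) : Set (lsuc (c ⊔ ℓ)) where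
  field
    commutativeRing : CommutativeRing c ℓ
  open CommutativeRing commutativeRing public
  field
    _⁻¹      : Carrier → Carrier
    ⁻¹-inv   : ∀ x → ¬ (x ≈ 0#) → x * (x ⁻¹) ≈ 1#
    ⁻¹-zero  : (0# ⁻¹) ≈ 0#
    0≉1      : ¬ (0# ≈ 1#)
    _≤_      : Rel Carrier ℓ
    ≤-isTotalOrder : IsTotalOrder _≈_ _≤_
    ≤-+      : ∀ {x y} z → x ≤ y → (x + z) ≤ (y + z)
    ≤-*      : ∀ {x y} → 0# ≤ x → 0# ≤ y → 0# ≤ (x * y)
    sup      : (P : Carrier → Set ℓ) → ∃ P → (∃ λ b → ∀ x → P x → x ≤ b) →
               ∃ λ s → (∀ x → P x → x ≤ s) × (∀ b → (∀ x → P x → x ≤ b) → s ≤ b)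

MatZ : Set
MatZ = Fin 3 → Fin 3 → ℤ

infixl 7 _·Z_
_·Z_ : MatZ → MatZ → MatZ
(A ·Z B) i j = A i 0F ℤ.* B 0F j ℤ.+ A i 1F ℤ.* B 1F j ℤ.+ A i 2F ℤ.* B 2F j

detZ : MatZ → ℤ
detZ A =
    A 0F 0F ℤ.* (A 1F 1F ℤ.* A 2F 2F ℤ.- A 1F 2F ℤ.* A 2F 1F)
  ℤ.- A 0F 1F ℤ.* (A 1F 0F ℤ.* A 2F 2F ℤ.- A 1F 2F ℤ.* A 2F 0F)
  ℤ.+ A 0F 2F ℤ.* (A 1F 0F ℤ.* A 2F 1F ℤ.- A 1F 1F ℤ.* A 2F 0F)

InSL3Z : MatZ → Set
InSL3Z A = detZ A ≡ + 1

InΓ∞ : MatZ → Set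
InΓ∞ A = (A 0F 0F ≡ + 1) × (A 1F 1F ≡ + 1) × (A 2F 2F ≡ + 1)
       × (A 1F 0F ≡ + 0) × (A 2F 0F ≡ + 0) × (A 2F 1F ≡ + 0)

InΓ₀ : ℕ → MatZ → Set
InΓ₀ N A = InSL3Z A × (+ N ∣ A 2F 0F) × (+ N ∣ A 2F 1F)

InSL2Z : ℤ → ℤ → ℤ → ℤ → Set
InSL2Z a b c d = a ℤ.* d ℤ.- b ℤ.* c ≡ + 1

ια : ℤ → ℤ → ℤ → ℤ → MatZ
ια a b c d 0F 0F = a
ια a b c d 0F 1F = b
ια a b c d 1F 0F = c
ια a b c d 1F 1F = d
ια a b c d 2F 2F = + 1
ια a b c d _  _  = + 0

ιβ : ℤ → ℤ → ℤ → ℤ → MatZ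
ιβ a b c d 0F 0F = + 1
ιβ a b c d 1F 1F = a
ιβ a b c d 1F 2F = b
ιβ a b c d 2F 1F = c
ιβ a b c d 2F 2F = d
ιβ a b c d _  _  = + 0

_≡M_ : MatZ → MatZ → Set
A ≡M B = ∀ i j → A i j ≡ B i j

wZ : MatZ
wZ 0F 2F = + 1
wZ 1F 0F = + 1
wZ 2F 1F = + 1
wZ _  _  = + 0

module OverReals {c ℓ : Level} (R : RealField c ℓ) where
  open RealField R

  Mat : Set c
  Mat = Fin 3 → Fin 3 → Carrier

  infixl 7 _·_
  _·_ : Mat → Mat → Mat
  (A · B) i j = A i 0F * B 0F j + A i 1F * B 1F j + A i 2F * B 2F j

  det : Mat → Carrier
  det A =
      A 0F 0F * (A 1F 1F * A 2F 2F - A 1F 2F * A 2F 1F)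
    - A 0F 1F * (A 1F 0F * A 2F 2F - A 1F 2F * A 2F 0F)
    + A 0F 2F * (A 1F 0F * A 2F 1F - A 1F 1F * A 2F 0F)

  _≈M_ : Mat → Mat → Set ℓ
  A ≈M B = ∀ i j → A i j ≈ B i j

  fromℕ : ℕ → Carrier
  fromℕ zero    = 0#
  fromℕ (suc n) = 1# + fromℕ n

  fromℤ : ℤ → Carrier
  fromℤ (+ n)    = fromℕ n
  fromℤ -[1+ n ] = - (1# + fromℕ n)

  embed : MatZ → Mat
  embed A i j = fromℤ (A i j)

  InB : Mat → Set ℓ
  InB M = (M 1F 0F ≈ 0#) × (M 2F 0F ≈ 0#) × (M 2F 1F ≈ 0#) × (det M ≈ 1#)

  InU : Mat → Set ℓ
  InU M = (M 0F 0F ≈ 1#) × (M 1F 1F ≈ 1#) × (M 2F 2F ≈ 1#)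
        × (M 1F 0F ≈ 0#) × (M 2F 0F ≈ 0#) × (M 2F 1F ≈ 0#)

  diag : Carrier → Carrier → Carrier → Mat
  diag x y z 0F 0F = x
  diag x y z 1F 1F = y
  diag x y z 2F 2F = z
  diag x y z _  _  = 0#

  t : Carrier → Carrier → Mat
  t c₁ c₂ = diag c₁ (c₂ * (c₁ ⁻¹)) (c₂ ⁻¹)

  w : Mat
  w = embed wZ

  InBwB-SL3Z : MatZ → Set (c ⊔ ℓ)
  InBwB-SL3Z A = InSL3Z A × ∃ λ b₁ → ∃ λ b₂ → InB b₁ × InB b₂ × (embed A ≈M (b₁ · w · b₂))

  InΩw : Carrier → Carrier → MatZ → Set (c ⊔ ℓ)
  InΩw c₁ c₂ A = InSL3Z A × ∃ λ uL → ∃ λ uR → InU uL × InU uR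
                 × (embed A ≈M (uL · w · t c₁ c₂ · uR))

{-# OPTIONS --safe #-}

-- For upper triangular b₁, b₂ the entries of b₁ w b₂ below the diagonal are 0, (b₁)₁₁(b₂)₀₀ and
-- (b₁)₂₂(b₂)₁₁, and the diagonal entries of b₁ and b₂ multiply to 1; so A ∈ BwB forces A₂₀ = 0 and
-- A₁₀A₂₁ ≠ 0, and likewise every A ∈ Ω_w(c₁, c₂) has (A₁₀, A₂₀, A₂₁) = (c₁, 0, c₂/c₁). Conversely, if
-- A ∈ SL₃(ℤ) has A₂₀ = 0 and d₁ = A₁₀, d₂ = A₂₁ nonzero, dividing the remaining entries by d₁ and d₂
-- gives unipotent u_L, u_R with A = u_L w t(d₁, d₁d₂) u_R, the corner entry being forced by det A = 1.
-- Thus Ω_w(d₁, d₁d₂) consists of the A ∈ SL₃(ℤ) with lower entries (d₁, 0, d₂); this gives both unions,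
-- N ∣ A₂₁ being N ∣ d₂. For such A an integral unipotent u built from the 2×2 minors of the top rows
-- gives uA = ια(γ₁) ιβ(γ₂) with γ₁ = (a₀₀, a₀₁a₂₂ − a₀₂a₂₁; a₁₀, a₁₁a₂₂ − a₁₂a₂₁) and
-- γ₂ = (a₀₀a₁₁ − a₀₁a₁₀, a₀₀a₁₂ − a₀₂a₁₀; a₂₁, a₂₂), both of determinant det A = 1.

module Submission where

open import Defs
open import Level using (Level; _⊔_)
open import Data.Nat using (ℕ; zero; suc)
import Data.Nat as ℕ
open import Data.Integer using (ℤ; +_; -[1+_])
open import Data.Integer.Divisibility using (_∣_)
import Data.Nat.Divisibility as ℕ∣
open import Data.Product using (∃; _×_; _,_; proj₁; proj₂)
open import Relation.Nullary using (¬_; yes; no)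
open import Data.Sum using (inj₁; inj₂)
open import Data.Maybe using (Maybe; just; nothing)
open import Data.Empty using (⊥-elim)
open import Relation.Binary.PropositionalEquality using (_≡_)
import Relation.Binary.PropositionalEquality as ≡
open import Data.Vec.N-ary using (N-ary)

open import Data.Fin using (Fin)
open import Data.Fin.Patterns using (0F; 1F; 2F)
import Data.Integer as ℤ
import Data.Integer.Properties as ℤP
open import Algebra.Bundles.Raw using (RawRing)
open import Relation.Binary.Structures using (IsTotalOrder)
open import Data.Integer.Solver using (module +-*-Solver)

-- Instantiated at the expressions of a ring solver, these definitions evaluate definitionally to
-- their counterparts on ℤ and on the reals in Defs, so matrix identities can be given to the solver.
module Matrix3 {c ℓ} (R : RawRing c ℓ) where
  open RawRing R

  Matrix : Set c
  Matrix = Fin 3 → Fin 3 → Carrier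

  infixl 6 _⊟_
  infixl 7 _⊙_

  _⊟_ : Carrier → Carrier → Carrier
  x ⊟ y = x + - y

  _⊙_ : Matrix → Matrix → Matrix
  (A ⊙ B) i j = A i 0F * B 0F j + A i 1F * B 1F j + A i 2F * B 2F j

  determinant : Matrix → Carrier
  determinant A =
      A 0F 0F * (A 1F 1F * A 2F 2F ⊟ A 1F 2F * A 2F 1F)
    ⊟ A 0F 1F * (A 1F 0F * A 2F 2F ⊟ A 1F 2F * A 2F 0F)
    + A 0F 2F * (A 1F 0F * A 2F 1F ⊟ A 1F 1F * A 2F 0F)

  matrix : Carrier → Carrier → Carrier → Carrier → Carrier → Carrier → Carrier → Carrier → Carrier → Matrix
  matrix a b c d e f g h k 0F 0F = a
  matrix a b c d e f g h k 0F 1F = b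
  matrix a b c d e f g h k 0F 2F = c
  matrix a b c d e f g h k 1F 0F = d
  matrix a b c d e f g h k 1F 1F = e
  matrix a b c d e f g h k 1F 2F = f
  matrix a b c d e f g h k 2F 0F = g
  matrix a b c d e f g h k 2F 1F = h
  matrix a b c d e f g h k 2F 2F = k

  upper : Carrier → Carrier → Carrier → Carrier → Carrier → Carrier → Matrix
  upper x p q y r z = matrix x p q 0# y r 0# 0# z

  unipotent : Carrier → Carrier → Carrier → Matrix
  unipotent p q r = upper 1# p q 1# r 1#

  diagonal : Carrier → Carrier → Carrier → Matrix
  diagonal x y z = upper x 0# 0# y 0# z

  -- Stand-ins for row i (column j) of a matrix when the index i (j) is a variable.
  constantRows : Carrier → Carrier → Carrier → Matrix
  constantRows a b c _ 0F = a
  constantRows a b c _ 1F = b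
  constantRows a b c _ 2F = c

  constantColumns : Carrier → Carrier → Carrier → Matrix
  constantColumns a b c 0F _ = a
  constantColumns a b c 1F _ = b
  constantColumns a b c 2F _ = c

  -- The product unipotent p q 0# · w · diagonal x y z · unipotent s v r.
  bruhatCell : Carrier → Carrier → Carrier → Carrier → Carrier → Carrier → Carrier → Carrier → Matrix
  bruhatCell p q s v r x y z =
    matrix (p * x) (p * x * s + q * y) (p * x * v + q * y * r + z) x (x * s) (x * v) 0# y (y * r)

  -- As in OverReals, so that cycle is the matrix w.
  fromℕ : ℕ → Carrier
  fromℕ zero    = 0#
  fromℕ (suc n) = 1# + fromℕ n

  fromℤ : ℤ → Carrier
  fromℤ (+ n)    = fromℕ n
  fromℤ -[1+ n ] = - (1# + fromℕ n)

  cycle : Matrix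
  cycle i j = fromℤ (wZ i j)

  embedα : Carrier → Carrier → Carrier → Carrier → Matrix
  embedα a b c d = matrix a b 0# c d 0# 0# 0# 1#

  embedβ : Carrier → Carrier → Carrier → Carrier → Matrix
  embedβ a b c d = matrix 1# 0# 0# 0# a b 0# c d

  minor : Matrix → Fin 3 → Fin 3 → Fin 3 → Fin 3 → Carrier
  minor A i i′ j j′ = A i j * A i′ j′ ⊟ A i j′ * A i′ j

  upperRightBlock : Matrix → Matrix
  upperRightBlock A 0F 1F = A 0F 1F
  upperRightBlock A 0F 2F = A 0F 2F
  upperRightBlock A 1F 1F = A 1F 1F
  upperRightBlock A 1F 2F = A 1F 2F
  upperRightBlock A _  _  = 0#

  γ∞-reducer : Matrix → Matrix
  γ∞-reducer A = unipotent 0# (A 0F 1F * minor A 0F 1F 0F 2F ⊟ A 0F 2F * minor A 0F 1F 0F 1F)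
                              (A 1F 1F * minor A 0F 1F 0F 2F ⊟ A 1F 2F * minor A 0F 1F 0F 1F)

syntacticRawRing : ∀ {a} {A : Set a} → (A → A → A) → (A → A → A) → (A → A) → A → A → RawRing a a
syntacticRawRing _+_ _*_ -_ 0# 1# = record
  { Carrier = _ ; _≈_ = _≡_ ; _+_ = _+_ ; _*_ = _*_ ; -_ = -_ ; 0# = 0# ; 1# = 1# }

module IntegerFactorisation where
  open ≡ using (refl; trans; cong)
  open +-*-Solver using (solve; _:=_; Polynomial; _:+_; _:*_; _:-_; :-_; con)
  open Matrix3 ℤ.+-*-rawRing using (matrix; unipotent; minor; upperRightBlock; γ∞-reducer)

  private
    module P {n : ℕ} = Matrix3 (syntacticRawRing {A = Polynomial n} _:+_ _:*_ :-_ (con (+ 0)) (con (+ 1)))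

    γ∞-reducer-identityᴾ : Fin 3 → Fin 3 → N-ary 8 (Polynomial 8) (Polynomial 8 × Polynomial 8)
    γ∞-reducer-identityᴾ i j a b c d e f g h =
      let A = P.matrix a b c d e f (con (+ 0)) g h in
      (P.γ∞-reducer A P.⊙ A P.⊙ P.unipotent (con (+ 0)) (con (+ 0)) (con (+ 0))) i j
        := (P.embedα (A 0F 0F) (P.minor A 0F 2F 1F 2F) (A 1F 0F) (P.minor A 1F 2F 1F 2F)
            P.⊙ P.embedβ (P.minor A 0F 1F 0F 1F) (P.minor A 0F 1F 0F 2F) (A 2F 1F) (A 2F 2F)) i j
           :+ P.upperRightBlock A i j :* (con (+ 1) :- P.determinant A)

  γ∞-reducer-identity : ∀ a b c d e f g h →
    let A = matrix a b c d e f (+ 0) g h in ∀ i j →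
    (γ∞-reducer A ·Z A ·Z unipotent (+ 0) (+ 0) (+ 0)) i j
      ≡ (ια (A 0F 0F) (minor A 0F 2F 1F 2F) (A 1F 0F) (minor A 1F 2F 1F 2F)
         ·Z ιβ (minor A 0F 1F 0F 1F) (minor A 0F 1F 0F 2F) (A 2F 1F) (A 2F 2F)) i j
        ℤ.+ upperRightBlock A i j ℤ.* (+ 1 ℤ.- detZ A)
  γ∞-reducer-identity a b c d e f g h 0F 0F = solve 8 (γ∞-reducer-identityᴾ 0F 0F) refl a b c d e f g h
  γ∞-reducer-identity a b c d e f g h 0F 1F = solve 8 (γ∞-reducer-identityᴾ 0F 1F) refl a b c d e f g h
  γ∞-reducer-identity a b c d e f g h 0F 2F = solve 8 (γ∞-reducer-identityᴾ 0F 2F) refl a b c d e f g h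
  γ∞-reducer-identity a b c d e f g h 1F 0F = solve 8 (γ∞-reducer-identityᴾ 1F 0F) refl a b c d e f g h
  γ∞-reducer-identity a b c d e f g h 1F 1F = solve 8 (γ∞-reducer-identityᴾ 1F 1F) refl a b c d e f g h
  γ∞-reducer-identity a b c d e f g h 1F 2F = solve 8 (γ∞-reducer-identityᴾ 1F 2F) refl a b c d e f g h
  γ∞-reducer-identity a b c d e f g h 2F 0F = solve 8 (γ∞-reducer-identityᴾ 2F 0F) refl a b c d e f g h
  γ∞-reducer-identity a b c d e f g h 2F 1F = solve 8 (γ∞-reducer-identityᴾ 2F 1F) refl a b c d e f g h
  γ∞-reducer-identity a b c d e f g h 2F 2F = solve 8 (γ∞-reducer-identityᴾ 2F 2F) refl a b c d e f g h

  det-embedα-block : ∀ a b c d e f g h → let A = matrix a b c d e f (+ 0) g h in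
    A 0F 0F ℤ.* minor A 1F 2F 1F 2F ℤ.- minor A 0F 2F 1F 2F ℤ.* A 1F 0F ≡ detZ A
  det-embedα-block = solve 8 (λ a b c d e f g h → let A = P.matrix a b c d e f (con (+ 0)) g h in
    A 0F 0F :* P.minor A 1F 2F 1F 2F :- P.minor A 0F 2F 1F 2F :* A 1F 0F := P.determinant A) refl

  det-embedβ-block : ∀ a b c d e f g h → let A = matrix a b c d e f (+ 0) g h in
    minor A 0F 1F 0F 1F ℤ.* A 2F 2F ℤ.- minor A 0F 1F 0F 2F ℤ.* A 2F 1F ≡ detZ A
  det-embedβ-block = solve 8 (λ a b c d e f g h → let A = P.matrix a b c d e f (con (+ 0)) g h in
    P.minor A 0F 1F 0F 1F :* A 2F 2F :- P.minor A 0F 1F 0F 2F :* A 2F 1F := P.determinant A) refl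

  ≡-modulo-det : ∀ {x y δ} c → δ ≡ + 1 → x ≡ y ℤ.+ c ℤ.* (+ 1 ℤ.- δ) → x ≡ y
  ≡-modulo-det {y = y} c refl x≡y+c·0 = trans x≡y+c·0 (trans (cong (λ z → y ℤ.+ z) (ℤP.*-zeroʳ c)) (ℤP.+-identityʳ y))

  IαIβ-Decomposition : ℤ → ℤ → MatZ → Set
  IαIβ-Decomposition d₁ d₂ A =
    ∃ λ (u : MatZ) → ∃ λ (u′ : MatZ) → InΓ∞ u × InΓ∞ u′ ×
    ∃ λ (x₁ : ℤ) → ∃ λ (b₁ : ℤ) → ∃ λ (y₁ : ℤ) → ∃ λ (x₂ : ℤ) → ∃ λ (b₂ : ℤ) → ∃ λ (y₂ : ℤ) →
      InSL2Z x₁ b₁ d₁ y₁ × InSL2Z x₂ b₂ d₂ y₂ ×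
      ((u ·Z A ·Z u′) ≡M (ια x₁ b₁ d₁ y₁ ·Z ιβ x₂ b₂ d₂ y₂))

  matrix-lower-zero⇒IαIβ-Decomposition : ∀ a b c d e f a₂₀ g h → a₂₀ ≡ + 0 →
    let A = matrix a b c d e f a₂₀ g h in InSL3Z A → IαIβ-Decomposition (A 1F 0F) (A 2F 1F) A
  matrix-lower-zero⇒IαIβ-Decomposition a b c d e f _ g h refl det≡1 =
    γ∞-reducer A , unipotent (+ 0) (+ 0) (+ 0) , (refl , refl , refl , refl , refl , refl) , (refl , refl , refl , refl , refl , refl) ,
    A 0F 0F , minor A 0F 2F 1F 2F , minor A 1F 2F 1F 2F , minor A 0F 1F 0F 1F , minor A 0F 1F 0F 2F , A 2F 2F ,
    trans (det-embedα-block a b c d e f g h) det≡1 , trans (det-embedβ-block a b c d e f g h) det≡1 ,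
    λ i j → ≡-modulo-det (upperRightBlock A i j) det≡1 (γ∞-reducer-identity a b c d e f g h i j)
    where
    A : MatZ
    A = matrix a b c d e f (+ 0) g h

  -- Products and determinants only read entries at literal indices, so at the entries of A the
  -- previous lemma is definitionally the statement about A.
  lower-zero⇒IαIβ-Decomposition : ∀ A → A 2F 0F ≡ + 0 → InSL3Z A → IαIβ-Decomposition (A 1F 0F) (A 2F 1F) A
  lower-zero⇒IαIβ-Decomposition A = matrix-lower-zero⇒IαIβ-Decomposition (A 0F 0F) (A 0F 1F) (A 0F 2F) (A 1F 0F) (A 1F 1F) (A 1F 2F) (A 2F 0F) (A 2F 1F) (A 2F 2F)

module ℤ-Embedding {c ℓ} (R : RealField c ℓ) where
  open RealField R
  open OverReals R using (fromℕ; fromℤ)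
  open import Algebra.Properties.Semiring.Mult semiring using (×-homo-+; ×1-homo-*) renaming (_×_ to _×ᵣ_)
  open import Algebra.Properties.Ring ring using (-‿involutive; -‿distribˡ-*; -‿distribʳ-*; -0#≈0#)
  open import Algebra.Properties.AbelianGroup +-abelianGroup using (⁻¹-∙-comm)
  open import Algebra.Properties.CommutativeSemigroup +-commutativeSemigroup using (interchange)
  open import Relation.Binary.Reasoning.Setoid setoid
  private module ≤ = IsTotalOrder ≤-isTotalOrder

  fromℕ≡× : ∀ n → fromℕ n ≡ n ×ᵣ 1#
  fromℕ≡× zero = ≡.refl
  fromℕ≡× (suc n) = ≡.cong (λ x → 1# + x) (fromℕ≡× n)

  fromℕ-+ : ∀ m n → fromℕ (m ℕ.+ n) ≈ fromℕ m + fromℕ n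
  fromℕ-+ m n rewrite fromℕ≡× (m ℕ.+ n) | fromℕ≡× m | fromℕ≡× n = ×-homo-+ 1# m n

  fromℕ-* : ∀ m n → fromℕ (m ℕ.* n) ≈ fromℕ m * fromℕ n
  fromℕ-* m n rewrite fromℕ≡× (m ℕ.* n) | fromℕ≡× m | fromℕ≡× n = ×1-homo-* m n

  private
    cancel-1# : ∀ x y → (1# + x) - (1# + y) ≈ x - y
    cancel-1# x y = begin
      (1# + x) + - (1# + y)   ≈⟨ +-congˡ (⁻¹-∙-comm 1# y) ⟨
      (1# + x) + (- 1# + - y) ≈⟨ interchange 1# x (- 1#) (- y) ⟩
      (1# + - 1#) + (x + - y) ≈⟨ +-congʳ (-‿inverseʳ 1#) ⟩
      0# + (x - y)            ≈⟨ +-identityˡ _ ⟩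
      x - y                   ∎

  fromℤ-⊖ : ∀ m n → fromℤ (m ℤ.⊖ n) ≈ fromℕ m - fromℕ n
  fromℤ-⊖ zero    zero    = sym (-‿inverseʳ 0#)
  fromℤ-⊖ zero    (suc n) = sym (+-identityˡ _)
  fromℤ-⊖ (suc m) zero    = sym (trans (+-congˡ -0#≈0#) (+-identityʳ _))
  fromℤ-⊖ (suc m) (suc n) = begin
    fromℤ (suc m ℤ.⊖ suc n)          ≡⟨ ≡.cong fromℤ (ℤP.[1+m]⊖[1+n]≡m⊖n m n) ⟩
    fromℤ (m ℤ.⊖ n)                  ≈⟨ fromℤ-⊖ m n ⟩
    fromℕ m - fromℕ n                ≈⟨ cancel-1# (fromℕ m) (fromℕ n) ⟨
    fromℕ (suc m) - fromℕ (suc n)    ∎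

  fromℤ-neg : ∀ i → fromℤ (ℤ.- i) ≈ - fromℤ i
  fromℤ-neg (+ zero)  = sym -0#≈0#
  fromℤ-neg (+ suc n) = refl
  fromℤ-neg -[1+ n ]  = sym (-‿involutive _)

  fromℤ-+ : ∀ i j → fromℤ (i ℤ.+ j) ≈ fromℤ i + fromℤ j
  fromℤ-+ -[1+ m ] -[1+ n ] = begin
    - (1# + (1# + fromℕ (m ℕ.+ n)))     ≈⟨ -‿cong (+-congˡ (+-congˡ (fromℕ-+ m n))) ⟩
    - (1# + (1# + (fromℕ m + fromℕ n))) ≈⟨ -‿cong (+-assoc _ _ _) ⟨
    - ((1# + 1#) + (fromℕ m + fromℕ n)) ≈⟨ -‿cong (interchange _ _ _ _) ⟩
    - (fromℕ (suc m) + fromℕ (suc n))   ≈⟨ ⁻¹-∙-comm _ _ ⟨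
    - fromℕ (suc m) + - fromℕ (suc n)   ∎
  fromℤ-+ -[1+ m ] (+ n)    = trans (fromℤ-⊖ n (suc m)) (+-comm _ _)
  fromℤ-+ (+ m)    -[1+ n ] = fromℤ-⊖ m (suc n)
  fromℤ-+ (+ m)    (+ n)    = fromℕ-+ m n

  fromℤ-sub : ∀ i j → fromℤ (i ℤ.- j) ≈ fromℤ i - fromℤ j
  fromℤ-sub i j = trans (fromℤ-+ i (ℤ.- j)) (+-congˡ (fromℤ-neg j))

  fromℤ-* : ∀ i j → fromℤ (i ℤ.* j) ≈ fromℤ i * fromℤ j
  fromℤ-* (+ m) (+ n) = begin
    fromℤ (+ m ℤ.* + n)  ≡⟨ ≡.cong fromℤ (ℤP.+◃n≡+n (m ℕ.* n)) ⟩
    fromℕ (m ℕ.* n)      ≈⟨ fromℕ-* m n ⟩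
    fromℕ m * fromℕ n    ∎
  fromℤ-* (+ m) -[1+ n ] = begin
    fromℤ (+ m ℤ.* -[1+ n ])         ≡⟨ ≡.cong fromℤ (ℤP.-◃n≡-n (m ℕ.* suc n)) ⟩
    fromℤ (ℤ.- (+ (m ℕ.* suc n)))    ≈⟨ fromℤ-neg (+ (m ℕ.* suc n)) ⟩
    - fromℕ (m ℕ.* suc n)            ≈⟨ -‿cong (fromℕ-* m (suc n)) ⟩
    - (fromℕ m * fromℕ (suc n))      ≈⟨ -‿distribʳ-* _ _ ⟩
    fromℕ m * - fromℕ (suc n)        ∎
  fromℤ-* -[1+ m ] (+ n) = begin
    fromℤ (-[1+ m ] ℤ.* + n)         ≡⟨ ≡.cong fromℤ (ℤP.-◃n≡-n (suc m ℕ.* n)) ⟩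
    fromℤ (ℤ.- (+ (suc m ℕ.* n)))    ≈⟨ fromℤ-neg (+ (suc m ℕ.* n)) ⟩
    - fromℕ (suc m ℕ.* n)            ≈⟨ -‿cong (fromℕ-* (suc m) n) ⟩
    - (fromℕ (suc m) * fromℕ n)      ≈⟨ -‿distribˡ-* _ _ ⟩
    - fromℕ (suc m) * fromℕ n        ∎
  fromℤ-* -[1+ m ] -[1+ n ] = begin
    fromℤ (-[1+ m ] ℤ.* -[1+ n ])      ≡⟨ ≡.cong fromℤ (ℤP.+◃n≡+n (suc m ℕ.* suc n)) ⟩
    fromℕ (suc m ℕ.* suc n)            ≈⟨ fromℕ-* (suc m) (suc n) ⟩
    fromℕ (suc m) * fromℕ (suc n)      ≈⟨ -‿involutive _ ⟨
    - - (fromℕ (suc m) * fromℕ (suc n)) ≈⟨ -‿cong (-‿distribˡ-* _ _) ⟩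
    - (- fromℕ (suc m) * fromℕ (suc n)) ≈⟨ -‿distribʳ-* _ _ ⟩
    - fromℕ (suc m) * - fromℕ (suc n)  ∎

  private
    ≤-resp-≈ : ∀ {x x′ y y′} → x ≈ x′ → y ≈ y′ → x ≤ y → x′ ≤ y′
    ≤-resp-≈ x≈x′ y≈y′ x≤y = ≤.≲-respˡ-≈ x≈x′ (≤.≲-respʳ-≈ y≈y′ x≤y)

  0≤1 : 0# ≤ 1#
  0≤1 with ≤.total 0# 1#
  ... | inj₁ 0≤1′ = 0≤1′
  ... | inj₂ 1≤0 = ≤.≲-respʳ-≈ -1*-1≈1 (≤-* 0≤-1 0≤-1)
    where
    0≤-1 : 0# ≤ (- 1#)
    0≤-1 = ≤-resp-≈ (-‿inverseʳ 1#) (+-identityˡ (- 1#)) (≤-+ (- 1#) 1≤0)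
    -1*-1≈1 : - 1# * - 1# ≈ 1#
    -1*-1≈1 = begin
      - 1# * - 1#    ≈⟨ -‿distribˡ-* 1# (- 1#) ⟨
      - (1# * - 1#)  ≈⟨ -‿cong (*-identityˡ (- 1#)) ⟩
      - - 1#         ≈⟨ -‿involutive 1# ⟩
      1#             ∎

  0≤fromℕ : ∀ n → 0# ≤ fromℕ n
  1≤fromℕ-suc : ∀ n → 1# ≤ fromℕ (suc n)

  0≤fromℕ zero    = ≤.refl
  0≤fromℕ (suc n) = ≤.trans 0≤1 (1≤fromℕ-suc n)

  1≤fromℕ-suc n = ≤-resp-≈ (+-identityˡ 1#) (+-comm (fromℕ n) 1#) (≤-+ 1# (0≤fromℕ n))

  fromℕ-suc≉0 : ∀ n → ¬ (fromℕ (suc n) ≈ 0#)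
  fromℕ-suc≉0 n 1+n≈0 = 0≉1 (≤.antisym 0≤1 (≤.≲-respʳ-≈ 1+n≈0 (1≤fromℕ-suc n)))

  fromℤ≈0⇒≡0 : ∀ i → fromℤ i ≈ 0# → i ≡ + 0
  fromℤ≈0⇒≡0 (+ zero)  _   = ≡.refl
  fromℤ≈0⇒≡0 (+ suc n) n≈0 = ⊥-elim (fromℕ-suc≉0 n n≈0)
  fromℤ≈0⇒≡0 -[1+ n ]  -n≈0 = ⊥-elim (fromℕ-suc≉0 n (trans (sym (-‿involutive _)) (trans (-‿cong -n≈0) -0#≈0#)))

  fromℤ-injective : ∀ i j → fromℤ i ≈ fromℤ j → i ≡ j
  fromℤ-injective i j i≈j = ℤP.i-j≡0⇒i≡j i j (fromℤ≈0⇒≡0 (i ℤ.- j) (trans (fromℤ-sub i j) (trans (+-congʳ i≈j) (-‿inverseʳ _))))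

module RealRingSolver {c ℓ} (R : RealField c ℓ) where
  open RealField R
  open OverReals R using (fromℤ)
  open ℤ-Embedding R
  open import Algebra.Solver.Ring.AlmostCommutativeRing using (fromCommutativeRing; _-Raw-AlmostCommutative⟶_)

  -- The solver reads its integer constants through fromℤ′, which differs from fromℤ only in
  -- sending 1 to 1# itself rather than to 1# + 0#, so that constants match the literal 1# in goals.
  fromℤ′ : ℤ → Carrier
  fromℤ′ (+ 1) = 1#
  fromℤ′ i     = fromℤ i

  fromℤ′≈fromℤ : ∀ i → fromℤ′ i ≈ fromℤ i
  fromℤ′≈fromℤ (+ 0)           = refl
  fromℤ′≈fromℤ (+ 1)           = sym (+-identityʳ 1#)
  fromℤ′≈fromℤ (+ suc (suc n)) = refl
  fromℤ′≈fromℤ -[1+ n ]        = refl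

  fromℤ′-homomorphism : ℤ.+-*-rawRing -Raw-AlmostCommutative⟶ fromCommutativeRing commutativeRing
  fromℤ′-homomorphism = record
    { ⟦_⟧    = fromℤ′
    ; +-homo = λ i j → trans (fromℤ′≈fromℤ (i ℤ.+ j)) (trans (fromℤ-+ i j) (sym (+-cong (fromℤ′≈fromℤ i) (fromℤ′≈fromℤ j))))
    ; *-homo = λ i j → trans (fromℤ′≈fromℤ (i ℤ.* j)) (trans (fromℤ-* i j) (sym (*-cong (fromℤ′≈fromℤ i) (fromℤ′≈fromℤ j))))
    ; -‿homo = λ i → trans (fromℤ′≈fromℤ (ℤ.- i)) (trans (fromℤ-neg i) (sym (-‿cong (fromℤ′≈fromℤ i))))
    ; 0-homo = refl
    ; 1-homo = refl
    }

  fromℤ′-≈? : ∀ i j → Maybe (fromℤ′ i ≈ fromℤ′ j)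
  fromℤ′-≈? i j with i ℤ.≟ j
  ... | yes ≡.refl = just refl
  ... | no _       = nothing

  open import Algebra.Solver.Ring ℤ.+-*-rawRing _ fromℤ′-homomorphism fromℤ′-≈?
    using (solve; _:=_; Polynomial; _:+_; _:*_; _:-_; :-_; con) public

  module P {n : ℕ} = Matrix3 (syntacticRawRing {A = Polynomial n} _:+_ _:*_ :-_ (con (+ 0)) (con (+ 1)))

module RealMatrices {c ℓ} (R : RealField c ℓ) where
  open RealField R
  open OverReals R
  open RealRingSolver R
  open import Relation.Binary.Reasoning.Setoid setoid
  open Matrix3 rawRing using (upper; unipotent; bruhatCell)

  ·-assoc : ∀ X Y Z → (X · Y · Z) ≈M (X · (Y · Z))
  ·-assoc X Y Z i j = solve 15 (λ x₀ x₁ x₂ a b c d e f g h k z₀ z₁ z₂ →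
      let X = P.constantRows x₀ x₁ x₂ ; Y = P.matrix a b c d e f g h k ; Z = P.constantColumns z₀ z₁ z₂ in
      (X P.⊙ Y P.⊙ Z) i j := (X P.⊙ (Y P.⊙ Z)) i j) refl
    (X i 0F) (X i 1F) (X i 2F) (Y 0F 0F) (Y 0F 1F) (Y 0F 2F) (Y 1F 0F) (Y 1F 1F) (Y 1F 2F) (Y 2F 0F) (Y 2F 1F) (Y 2F 2F) (Z 0F j) (Z 1F j) (Z 2F j)

  ·w·-entry : ∀ X Y i j → (X · w · Y) i j ≈ X i 1F * Y 0F j + X i 2F * Y 1F j + X i 0F * Y 2F j
  ·w·-entry X Y i j = solve 6 (λ x₀ x₁ x₂ y₀ y₁ y₂ →
      (P.constantRows x₀ x₁ x₂ P.⊙ P.cycle P.⊙ P.constantColumns y₀ y₁ y₂) i j := x₁ :* y₀ :+ x₂ :* y₁ :+ x₀ :* y₂) refl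
    (X i 0F) (X i 1F) (X i 2F) (Y 0F j) (Y 1F j) (Y 2F j)

  det-cong : ∀ {A A′} → A ≈M A′ → det A ≈ det A′
  det-cong {A} {A′} A≈ = +-cong (+-cong (*-cong (A≈ 0F 0F) (minor≈ 1F 1F 2F 2F 1F 2F 2F 1F))
                                       (-‿cong (*-cong (A≈ 0F 1F) (minor≈ 1F 0F 2F 2F 1F 2F 2F 0F))))
                               (*-cong (A≈ 0F 2F) (minor≈ 1F 0F 2F 1F 1F 1F 2F 0F))
    where
    minor≈ : ∀ i j k l m n o p → A i j * A k l - A m n * A o p ≈ A′ i j * A′ k l - A′ m n * A′ o p
    minor≈ i j k l m n o p = +-cong (*-cong (A≈ i j) (A≈ k l)) (-‿cong (*-cong (A≈ m n) (A≈ o p)))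

  IsUpper : Mat → Set ℓ
  IsUpper M = (M 1F 0F ≈ 0#) × (M 2F 0F ≈ 0#) × (M 2F 1F ≈ 0#)

  InB⇒IsUpper : ∀ {M} → InB M → IsUpper M
  InB⇒IsUpper (m₁₀ , m₂₀ , m₂₁ , _) = m₁₀ , m₂₀ , m₂₁

  InU⇒IsUpper : ∀ {M} → InU M → IsUpper M
  InU⇒IsUpper (_ , _ , _ , m₁₀ , m₂₀ , m₂₁) = m₁₀ , m₂₀ , m₂₁

  IsUpper⇒≈upper : ∀ {M} → IsUpper M → M ≈M upper (M 0F 0F) (M 0F 1F) (M 0F 2F) (M 1F 1F) (M 1F 2F) (M 2F 2F)
  IsUpper⇒≈upper _                 0F 0F = refl
  IsUpper⇒≈upper _                 0F 1F = refl
  IsUpper⇒≈upper _                 0F 2F = refl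
  IsUpper⇒≈upper (m₁₀ , _ , _)     1F 0F = m₁₀
  IsUpper⇒≈upper _                 1F 1F = refl
  IsUpper⇒≈upper _                 1F 2F = refl
  IsUpper⇒≈upper (_ , m₂₀ , _)     2F 0F = m₂₀
  IsUpper⇒≈upper (_ , _ , m₂₁)     2F 1F = m₂₁
  IsUpper⇒≈upper _                 2F 2F = refl

  det-upper : ∀ x p q y r z → det (upper x p q y r z) ≈ x * y * z
  det-upper = solve 6 (λ x p q y r z → P.determinant (P.upper x p q y r z) := x :* y :* z) refl

  det-IsUpper : ∀ {M} → IsUpper M → det M ≈ M 0F 0F * M 1F 1F * M 2F 2F
  det-IsUpper {M} M-upper = trans (det-cong {M} (IsUpper⇒≈upper M-upper)) (det-upper _ _ _ _ _ _)

  det-diag-· : ∀ x y z M → det (diag x y z · M) ≈ x * y * z * det M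
  det-diag-· x y z M = solve 12 (λ x y z a b c d e f g h k →
      let M = P.matrix a b c d e f g h k in P.determinant (P.diagonal x y z P.⊙ M) := x :* y :* z :* P.determinant M) refl
    x y z (M 0F 0F) (M 0F 1F) (M 0F 2F) (M 1F 0F) (M 1F 1F) (M 1F 2F) (M 2F 0F) (M 2F 1F) (M 2F 2F)

  diag-·-entry : ∀ x y z M i j → (diag x y z · M) i j ≈ diag x y z i i * M i j
  diag-·-entry x y z M 0F j = solve 6 (λ x y z m₀ m₁ m₂ → (P.diagonal x y z P.⊙ P.constantColumns m₀ m₁ m₂) 0F j := x :* m₀) refl
    x y z (M 0F j) (M 1F j) (M 2F j)
  diag-·-entry x y z M 1F j = solve 6 (λ x y z m₀ m₁ m₂ → (P.diagonal x y z P.⊙ P.constantColumns m₀ m₁ m₂) 1F j := y :* m₁) refl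
    x y z (M 0F j) (M 1F j) (M 2F j)
  diag-·-entry x y z M 2F j = solve 6 (λ x y z m₀ m₁ m₂ → (P.diagonal x y z P.⊙ P.constantColumns m₀ m₁ m₂) 2F j := z :* m₂) refl
    x y z (M 0F j) (M 1F j) (M 2F j)

  diag-·-IsUpper : ∀ x y z M → IsUpper M → IsUpper (diag x y z · M)
  diag-·-IsUpper x y z M (m₁₀ , m₂₀ , m₂₁) = vanishes 1F 0F m₁₀ , vanishes 2F 0F m₂₀ , vanishes 2F 1F m₂₁
    where
    vanishes : ∀ i j → M i j ≈ 0# → (diag x y z · M) i j ≈ 0#
    vanishes i j m≈0 = trans (diag-·-entry x y z M i j) (trans (*-congˡ m≈0) (zeroʳ _))

  ·w·-lower-entries : ∀ U V → IsUpper U → IsUpper V →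
    ((U · w · V) 2F 0F ≈ 0#) × ((U · w · V) 1F 0F ≈ U 1F 1F * V 0F 0F) × ((U · w · V) 2F 1F ≈ U 2F 2F * V 1F 1F)
  ·w·-lower-entries U V (u₁₀ , u₂₀ , u₂₁) (v₁₀ , v₂₀ , v₂₁) =
    trans (·w·-entry U V 2F 0F) (trans (+-cong (+-cong (*-congʳ u₂₁) (*-congˡ v₁₀)) (*-congʳ u₂₀))
      (solve 3 (λ a b c → o :* a :+ b :* o :+ o :* c := o) refl _ _ _)) ,
    trans (·w·-entry U V 1F 0F) (trans (+-cong (+-congˡ (*-congˡ v₁₀)) (*-congʳ u₁₀))
      (solve 4 (λ a b c d → a :* b :+ c :* o :+ o :* d := a :* b) refl _ _ _ _)) ,
    trans (·w·-entry U V 2F 1F) (trans (+-cong (+-congʳ (*-congʳ u₂₁)) (*-congʳ u₂₀))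
      (solve 4 (λ a b c d → o :* a :+ b :* c :+ o :* d := b :* c) refl _ _ _ _))
    where
    o : ∀ {n} → Polynomial n
    o = con (+ 0)

  private
    bruhat-cellᴾ : Fin 3 → Fin 3 → N-ary 8 (Polynomial 8) (Polynomial 8 × Polynomial 8)
    bruhat-cellᴾ i j p q s v r x y z =
      (P.unipotent p q (con (+ 0)) P.⊙ P.cycle P.⊙ P.diagonal x y z P.⊙ P.unipotent s v r) i j := P.bruhatCell p q s v r x y z i j

  bruhat-cell : ∀ p q s v r x y z → (unipotent p q 0# · w · diag x y z · unipotent s v r) ≈M bruhatCell p q s v r x y z
  bruhat-cell p q s v r x y z 0F 0F = solve 8 (bruhat-cellᴾ 0F 0F) refl p q s v r x y z
  bruhat-cell p q s v r x y z 0F 1F = solve 8 (bruhat-cellᴾ 0F 1F) refl p q s v r x y z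
  bruhat-cell p q s v r x y z 0F 2F = solve 8 (bruhat-cellᴾ 0F 2F) refl p q s v r x y z
  bruhat-cell p q s v r x y z 1F 0F = solve 8 (bruhat-cellᴾ 1F 0F) refl p q s v r x y z
  bruhat-cell p q s v r x y z 1F 1F = solve 8 (bruhat-cellᴾ 1F 1F) refl p q s v r x y z
  bruhat-cell p q s v r x y z 1F 2F = solve 8 (bruhat-cellᴾ 1F 2F) refl p q s v r x y z
  bruhat-cell p q s v r x y z 2F 0F = solve 8 (bruhat-cellᴾ 2F 0F) refl p q s v r x y z
  bruhat-cell p q s v r x y z 2F 1F = solve 8 (bruhat-cellᴾ 2F 1F) refl p q s v r x y z
  bruhat-cell p q s v r x y z 2F 2F = solve 8 (bruhat-cellᴾ 2F 2F) refl p q s v r x y z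

  det-bruhatCell : ∀ p q s v r x y z → det (bruhatCell p q s v r x y z) ≈ x * y * z
  det-bruhatCell = solve 8 (λ p q s v r x y z → P.determinant (P.bruhatCell p q s v r x y z) := x :* y :* z) refl

  x≈y+[x-y] : ∀ x y → x ≈ y + (x - y)
  x≈y+[x-y] = solve 2 (λ x y → x := y :+ (x :- y)) refl

  cancelʳ : ∀ {u u′} → u * u′ ≈ 1# → ∀ a → a * u′ * u ≈ a
  cancelʳ {u} {u′} uu′≈1 a = begin
    a * u′ * u    ≈⟨ solve 3 (λ a u u′ → a :* u′ :* u := a :* (u :* u′)) refl a u u′ ⟩
    a * (u * u′)  ≈⟨ *-congˡ uu′≈1 ⟩
    a * 1#        ≈⟨ *-identityʳ a ⟩
    a             ∎

  cancelˡ : ∀ {u u′} → u * u′ ≈ 1# → ∀ a → u * (a * u′) ≈ a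
  cancelˡ {u} {u′} uu′≈1 a = trans (solve 3 (λ a u u′ → u :* (a :* u′) := a :* u′ :* u) refl a u u′) (cancelʳ uu′≈1 a)

  inverse-unique : ∀ {u z z′} → z * u ≈ 1# → u * z′ ≈ 1# → z′ ≈ z
  inverse-unique {u} {z} {z′} zu≈1 uz′≈1 = begin
    z′              ≈⟨ cancelʳ zu≈1 z′ ⟨
    z′ * u * z      ≈⟨ solve 3 (λ u z z′ → z′ :* u :* z := z :* (u :* z′)) refl u z z′ ⟩
    z * (u * z′)    ≈⟨ *-congˡ uz′≈1 ⟩
    z * 1#          ≈⟨ *-identityʳ z ⟩
    z               ∎

  t-entries-product : ∀ {c₁ c₂} → ¬ (c₁ ≈ 0#) → ¬ (c₂ ≈ 0#) → c₂ ⁻¹ * (c₁ * (c₂ * c₁ ⁻¹)) ≈ 1#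
  t-entries-product {c₁} {c₂} c₁≉0 c₂≉0 = begin
    c₂ ⁻¹ * (c₁ * (c₂ * c₁ ⁻¹))         ≈⟨ solve 4 (λ a b a′ b′ → b′ :* (a :* (b :* a′)) := (a :* a′) :* (b :* b′)) refl c₁ c₂ (c₁ ⁻¹) (c₂ ⁻¹) ⟩
    (c₁ * c₁ ⁻¹) * (c₂ * c₂ ⁻¹)         ≈⟨ *-cong (⁻¹-inv c₁ c₁≉0) (⁻¹-inv c₂ c₂≉0) ⟩
    1# * 1#                             ≈⟨ *-identityʳ 1# ⟩
    1#                                  ∎

  module _ (M : Mat) {x y z : Carrier} (xyz≈1 : z * (x * y) ≈ 1#) (m₁₀ : M 1F 0F ≈ x) (m₂₀ : M 2F 0F ≈ 0#) (m₂₁ : M 2F 1F ≈ y) where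

    private
      x⁻¹′ y⁻¹′ : Carrier
      x⁻¹′ = y * z
      y⁻¹′ = x * z

      x*x⁻¹′ : x * x⁻¹′ ≈ 1#
      x*x⁻¹′ = trans (solve 3 (λ x y z → x :* (y :* z) := z :* (x :* y)) refl x y z) xyz≈1

      y*y⁻¹′ : y * y⁻¹′ ≈ 1#
      y*y⁻¹′ = trans (solve 3 (λ x y z → y :* (x :* z) := z :* (x :* y)) refl x y z) xyz≈1

    bruhat-p bruhat-q bruhat-s bruhat-v bruhat-r : Carrier
    bruhat-p = M 0F 0F * x⁻¹′
    bruhat-s = M 1F 1F * x⁻¹′
    bruhat-v = M 1F 2F * x⁻¹′
    bruhat-r = M 2F 2F * y⁻¹′
    bruhat-q = (M 0F 1F - bruhat-p * x * bruhat-s) * y⁻¹′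

    private
      cell : Carrier → Mat
      cell = bruhatCell bruhat-p bruhat-q bruhat-s bruhat-v bruhat-r x y

      agrees-with-cell : ∀ z′ → M 0F 2F ≈ cell z′ 0F 2F → M ≈M cell z′
      agrees-with-cell z′ m₀₂ 0F 0F = sym (cancelʳ x*x⁻¹′ (M 0F 0F))
      agrees-with-cell z′ m₀₂ 0F 1F = begin
        M 0F 1F                   ≈⟨ x≈y+[x-y] (M 0F 1F) pxs ⟩
        pxs + (M 0F 1F - pxs)     ≈⟨ +-congˡ (cancelʳ y*y⁻¹′ (M 0F 1F - pxs)) ⟨
        pxs + bruhat-q * y        ∎
        where
        pxs : Carrier
        pxs = bruhat-p * x * bruhat-s
      agrees-with-cell z′ m₀₂ 0F 2F = m₀₂
      agrees-with-cell z′ m₀₂ 1F 0F = m₁₀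
      agrees-with-cell z′ m₀₂ 1F 1F = sym (cancelˡ x*x⁻¹′ (M 1F 1F))
      agrees-with-cell z′ m₀₂ 1F 2F = sym (cancelˡ x*x⁻¹′ (M 1F 2F))
      agrees-with-cell z′ m₀₂ 2F 0F = m₂₀
      agrees-with-cell z′ m₀₂ 2F 1F = m₂₁
      agrees-with-cell z′ m₀₂ 2F 2F = sym (cancelˡ y*y⁻¹′ (M 2F 2F))

    -- M agrees with the cell whose corner parameter is z′ := M₀₂ − e, so x y z′ = det M = 1 and z′ = z.
    ≈bruhat-cell : det M ≈ 1# → M ≈M bruhatCell bruhat-p bruhat-q bruhat-s bruhat-v bruhat-r x y z
    ≈bruhat-cell det≈1 = agrees-with-cell z (trans m₀₂≈e+z′ (+-congˡ z′≈z))
      where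
      e z′ : Carrier
      e = bruhat-p * x * bruhat-v + bruhat-q * y * bruhat-r
      z′ = M 0F 2F - e
      m₀₂≈e+z′ : M 0F 2F ≈ e + z′
      m₀₂≈e+z′ = x≈y+[x-y] (M 0F 2F) e
      z′≈z : z′ ≈ z
      z′≈z = inverse-unique xyz≈1 (trans (sym (det-bruhatCell _ _ _ _ _ x y z′)) (trans (sym (det-cong (agrees-with-cell z′ m₀₂≈e+z′))) det≈1))

module BruhatCells {c ℓ} (R : RealField c ℓ) where
  open RealField R
  open IntegerFactorisation using (IαIβ-Decomposition; lower-zero⇒IαIβ-Decomposition)
  open OverReals R
  open ℤ-Embedding R
  open RealRingSolver R
  open RealMatrices R
  open Matrix3 rawRing using (unipotent)
  open import Relation.Binary.Reasoning.Setoid setoid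

  fromℤ-≉0 : ∀ {i} → ¬ (i ≡ + 0) → ¬ (fromℤ i ≈ 0#)
  fromℤ-≉0 {i} i≢0 i≈0 = i≢0 (fromℤ≈0⇒≡0 i i≈0)

  fromℤ-minor : ∀ a b c d → fromℤ (a ℤ.* b ℤ.- c ℤ.* d) ≈ fromℤ a * fromℤ b - fromℤ c * fromℤ d
  fromℤ-minor a b c d = trans (fromℤ-sub (a ℤ.* b) (c ℤ.* d)) (+-cong (fromℤ-* a b) (-‿cong (fromℤ-* c d)))

  fromℤ-det : ∀ A → fromℤ (detZ A) ≈ det (embed A)
  fromℤ-det A = trans (fromℤ-+ (T₀ ℤ.- T₁) T₂) (+-cong (trans (fromℤ-sub T₀ T₁) (+-cong (term 0F 1F 1F 2F 2F 1F 2F 2F 1F)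
                                                                                    (-‿cong (term 1F 1F 0F 2F 2F 1F 2F 2F 0F))))
                                                      (term 2F 1F 0F 2F 1F 1F 1F 2F 0F))
    where
    T₀ T₁ T₂ : ℤ
    T₀ = A 0F 0F ℤ.* (A 1F 1F ℤ.* A 2F 2F ℤ.- A 1F 2F ℤ.* A 2F 1F)
    T₁ = A 0F 1F ℤ.* (A 1F 0F ℤ.* A 2F 2F ℤ.- A 1F 2F ℤ.* A 2F 0F)
    T₂ = A 0F 2F ℤ.* (A 1F 0F ℤ.* A 2F 1F ℤ.- A 1F 1F ℤ.* A 2F 0F)
    term : ∀ j k l m n o p q r → fromℤ (A 0F j ℤ.* (A k l ℤ.* A m n ℤ.- A o p ℤ.* A q r))
                                ≈ fromℤ (A 0F j) * (fromℤ (A k l) * fromℤ (A m n) - fromℤ (A o p) * fromℤ (A q r))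
    term j k l m n o p q r = trans (fromℤ-* (A 0F j) _) (*-congˡ (fromℤ-minor (A k l) (A m n) (A o p) (A q r)))

  IsUpper⇒InB : ∀ {M} → IsUpper M → det M ≈ 1# → InB M
  IsUpper⇒InB (m₁₀ , m₂₀ , m₂₁) det≈1 = m₁₀ , m₂₀ , m₂₁ , det≈1

  InU⇒InB : ∀ {M} → InU M → InB M
  InU⇒InB {M} M∈U@(m₀₀ , m₁₁ , m₂₂ , _) =
    IsUpper⇒InB {M} (InU⇒IsUpper {M} M∈U) (trans (det-IsUpper {M} (InU⇒IsUpper {M} M∈U))
      (trans (*-cong (*-cong m₀₀ m₁₁) m₂₂) (trans (*-identityʳ _) (*-identityʳ 1#))))

  InBwB⇒lower-entries : ∀ A → InBwB-SL3Z A → (A 2F 0F ≡ + 0) × ¬ (A 1F 0F ℤ.* A 2F 1F ≡ + 0)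
  InBwB⇒lower-entries A (_ , U , V , U∈B , V∈B , A≈UwV) = fromℤ≈0⇒≡0 (A 2F 0F) (trans (A≈UwV 2F 0F) a₂₀) , a₁₀a₂₁≢0
    where
    U-upper : IsUpper U
    U-upper = InB⇒IsUpper {U} U∈B
    V-upper : IsUpper V
    V-upper = InB⇒IsUpper {V} V∈B
    a₂₀ : (U · w · V) 2F 0F ≈ 0#
    a₂₀ = proj₁ (·w·-lower-entries U V U-upper V-upper)
    a₁₀ : fromℤ (A 1F 0F) ≈ U 1F 1F * V 0F 0F
    a₁₀ = trans (A≈UwV 1F 0F) (proj₁ (proj₂ (·w·-lower-entries U V U-upper V-upper)))
    a₂₁ : fromℤ (A 2F 1F) ≈ U 2F 2F * V 1F 1F
    a₂₁ = trans (A≈UwV 2F 1F) (proj₂ (proj₂ (·w·-lower-entries U V U-upper V-upper)))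
    diagonal-product : ∀ {M} → InB M → M 0F 0F * M 1F 1F * M 2F 2F ≈ 1#
    diagonal-product {M} M∈B = trans (sym (det-IsUpper {M} (InB⇒IsUpper {M} M∈B))) (proj₂ (proj₂ (proj₂ M∈B)))
    a₁₀a₂₁≢0 : ¬ (A 1F 0F ℤ.* A 2F 1F ≡ + 0)
    a₁₀a₂₁≢0 a₁₀a₂₁≡0 = 0≉1 (sym (begin
      1#                                                               ≈⟨ *-identityʳ 1# ⟨
      1# * 1#                                                          ≈⟨ *-cong (diagonal-product {U} U∈B) (diagonal-product {V} V∈B) ⟨
      (U 0F 0F * U 1F 1F * U 2F 2F) * (V 0F 0F * V 1F 1F * V 2F 2F)     ≈⟨ solve 6 (λ a b c d e f → (a :* b :* c) :* (d :* e :* f) := ((b :* d) :* (c :* e)) :* (a :* f)) refl _ _ _ _ _ _ ⟩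
      ((U 1F 1F * V 0F 0F) * (U 2F 2F * V 1F 1F)) * (U 0F 0F * V 2F 2F) ≈⟨ *-congʳ (*-cong a₁₀ a₂₁) ⟨
      (fromℤ (A 1F 0F) * fromℤ (A 2F 1F)) * (U 0F 0F * V 2F 2F)       ≈⟨ *-congʳ (fromℤ-* (A 1F 0F) (A 2F 1F)) ⟨
      fromℤ (A 1F 0F ℤ.* A 2F 1F) * (U 0F 0F * V 2F 2F)               ≈⟨ *-congʳ (reflexive (≡.cong fromℤ a₁₀a₂₁≡0)) ⟩
      0# * (U 0F 0F * V 2F 2F)                                         ≈⟨ zeroˡ _ ⟩
      0#                                                               ∎))

  private
    reassociate : ∀ A U D V → embed A ≈M (U · w · D · V) → embed A ≈M (U · w · (D · V))
    reassociate A U D V A≈ i j = trans (A≈ i j) (·-assoc (U · w) D V i j)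

  InΩw⇒lower-entries : ∀ {c₁ c₂} A → InΩw c₁ c₂ A →
    (fromℤ (A 2F 0F) ≈ 0#) × (fromℤ (A 1F 0F) ≈ c₁) × (fromℤ (A 2F 1F) ≈ c₂ * c₁ ⁻¹)
  InΩw⇒lower-entries {c₁} {c₂} A (_ , uL , uR , uL∈U@(_ , l₁₁ , l₂₂ , _) , uR∈U@(r₀₀ , r₁₁ , _) , A≈) =
    trans (A≈′ 2F 0F) a₂₀ ,
    trans (A≈′ 1F 0F) (trans a₁₀ (trans (*-cong l₁₁ (trans (diag-·-entry c₁ y z uR 0F 0F) (*-congˡ r₀₀)))
                                        (trans (*-identityˡ _) (*-identityʳ c₁)))) ,
    trans (A≈′ 2F 1F) (trans a₂₁ (trans (*-cong l₂₂ (trans (diag-·-entry c₁ y z uR 1F 1F) (*-congˡ r₁₁)))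
                                        (trans (*-identityˡ _) (*-identityʳ y))))
    where
    y z : Carrier
    y = c₂ * c₁ ⁻¹
    z = c₂ ⁻¹
    V : Mat
    V = t c₁ c₂ · uR
    A≈′ : embed A ≈M (uL · w · V)
    A≈′ = reassociate A uL (t c₁ c₂) uR A≈
    lower : ((uL · w · V) 2F 0F ≈ 0#) × ((uL · w · V) 1F 0F ≈ uL 1F 1F * V 0F 0F) × ((uL · w · V) 2F 1F ≈ uL 2F 2F * V 1F 1F)
    lower = ·w·-lower-entries uL V (InU⇒IsUpper {uL} uL∈U) (diag-·-IsUpper c₁ y z uR (InU⇒IsUpper {uR} uR∈U))
    a₂₀ : (uL · w · V) 2F 0F ≈ 0#
    a₂₀ = proj₁ lower
    a₁₀ : (uL · w · V) 1F 0F ≈ uL 1F 1F * V 0F 0F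
    a₁₀ = proj₁ (proj₂ lower)
    a₂₁ : (uL · w · V) 2F 1F ≈ uL 2F 2F * V 1F 1F
    a₂₁ = proj₂ (proj₂ lower)

  InΩw⇒InBwB : ∀ {c₁ c₂} A → ¬ (c₁ ≈ 0#) → ¬ (c₂ ≈ 0#) → InΩw c₁ c₂ A → InBwB-SL3Z A
  InΩw⇒InBwB {c₁} {c₂} A c₁≉0 c₂≉0 (A∈SL , uL , uR , uL∈U , uR∈U , A≈) =
    A∈SL , uL , t c₁ c₂ · uR , InU⇒InB {uL} uL∈U , IsUpper⇒InB {t c₁ c₂ · uR} V-upper det≈1 , reassociate A uL (t c₁ c₂) uR A≈
    where
    y z : Carrier
    y = c₂ * c₁ ⁻¹
    z = c₂ ⁻¹
    V-upper : IsUpper (t c₁ c₂ · uR)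
    V-upper = diag-·-IsUpper c₁ y z uR (InU⇒IsUpper {uR} uR∈U)
    det≈1 : det (t c₁ c₂ · uR) ≈ 1#
    det≈1 = begin
      det (t c₁ c₂ · uR)        ≈⟨ det-diag-· c₁ y z uR ⟩
      c₁ * y * z * det uR       ≈⟨ *-cong (*-comm _ z) (proj₂ (proj₂ (proj₂ (InU⇒InB {uR} uR∈U)))) ⟩
      z * (c₁ * y) * 1#         ≈⟨ *-identityʳ _ ⟩
      z * (c₁ * y)              ≈⟨ t-entries-product c₁≉0 c₂≉0 ⟩
      1#                        ∎

  left-factor-≢0 : ∀ {i j} → ¬ (i ℤ.* j ≡ + 0) → ¬ (i ≡ + 0)
  left-factor-≢0 {j = j} ij≢0 i≡0 = ij≢0 (≡.trans (≡.cong (ℤ._* j) i≡0) (ℤP.*-zeroˡ j))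

  fromℤ-quotient : ∀ d₁ d₂ → ¬ (fromℤ d₁ ≈ 0#) → fromℤ (d₁ ℤ.* d₂) * fromℤ d₁ ⁻¹ ≈ fromℤ d₂
  fromℤ-quotient d₁ d₂ c₁≉0 = begin
    fromℤ (d₁ ℤ.* d₂) * fromℤ d₁ ⁻¹     ≈⟨ *-congʳ (trans (fromℤ-* d₁ d₂) (*-comm (fromℤ d₁) (fromℤ d₂))) ⟩
    fromℤ d₂ * fromℤ d₁ * fromℤ d₁ ⁻¹   ≈⟨ cancelʳ (trans (*-comm (fromℤ d₁ ⁻¹) (fromℤ d₁)) (⁻¹-inv (fromℤ d₁) c₁≉0)) (fromℤ d₂) ⟩
    fromℤ d₂                            ∎

  lower-entries⇒InΩw : ∀ A {d₁ d₂} → InSL3Z A → A 2F 0F ≡ + 0 → A 1F 0F ≡ d₁ → A 2F 1F ≡ d₂ → ¬ (d₁ ℤ.* d₂ ≡ + 0) →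
                       InΩw (fromℤ d₁) (fromℤ (d₁ ℤ.* d₂)) A
  lower-entries⇒InΩw A {d₁} {d₂} A∈SL a₂₀≡0 a₁₀≡d₁ a₂₁≡d₂ d₁d₂≢0 =
    A∈SL , unipotent p q 0# , unipotent s v r , (refl , refl , refl , refl , refl , refl) , (refl , refl , refl , refl , refl , refl) ,
    λ i j → trans (≈bruhat-cell M xyz≈1 m₁₀ m₂₀ m₂₁ det≈1 i j) (sym (bruhat-cell p q s v r c₁ y z i j))
    where
    M : Mat
    M = embed A
    c₁ c₂ y z : Carrier
    c₁ = fromℤ d₁
    c₂ = fromℤ (d₁ ℤ.* d₂)
    y = c₂ * c₁ ⁻¹
    z = c₂ ⁻¹
    c₁≉0 : ¬ (c₁ ≈ 0#)
    c₁≉0 = fromℤ-≉0 {d₁} (left-factor-≢0 d₁d₂≢0)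
    xyz≈1 : z * (c₁ * y) ≈ 1#
    xyz≈1 = t-entries-product c₁≉0 (fromℤ-≉0 {d₁ ℤ.* d₂} d₁d₂≢0)
    m₁₀ : M 1F 0F ≈ c₁
    m₁₀ = reflexive (≡.cong fromℤ a₁₀≡d₁)
    m₂₀ : M 2F 0F ≈ 0#
    m₂₀ = reflexive (≡.cong fromℤ a₂₀≡0)
    m₂₁ : M 2F 1F ≈ y
    m₂₁ = trans (reflexive (≡.cong fromℤ a₂₁≡d₂)) (sym (fromℤ-quotient d₁ d₂ c₁≉0))
    det≈1 : det M ≈ 1#
    det≈1 = trans (sym (fromℤ-det A)) (trans (reflexive (≡.cong fromℤ A∈SL)) (+-identityʳ 1#))
    p q s v r : Carrier
    p = bruhat-p M xyz≈1 m₁₀ m₂₀ m₂₁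
    q = bruhat-q M xyz≈1 m₁₀ m₂₀ m₂₁
    s = bruhat-s M xyz≈1 m₁₀ m₂₀ m₂₁
    v = bruhat-v M xyz≈1 m₁₀ m₂₀ m₂₁
    r = bruhat-r M xyz≈1 m₁₀ m₂₀ m₂₁

  InΩw-ℤ : ℤ → ℤ → MatZ → Set (c ⊔ ℓ)
  InΩw-ℤ d₁ d₂ A = ¬ (d₁ ℤ.* d₂ ≡ + 0) × InΩw (fromℤ d₁) (fromℤ (d₁ ℤ.* d₂)) A

  InΩw-ℤ⇒lower-entries : ∀ d₁ d₂ A → InΩw-ℤ d₁ d₂ A → (A 2F 0F ≡ + 0) × (A 1F 0F ≡ d₁) × (A 2F 1F ≡ d₂)
  InΩw-ℤ⇒lower-entries d₁ d₂ A (d₁d₂≢0 , A∈Ω) =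
    fromℤ≈0⇒≡0 (A 2F 0F) a₂₀≈0 ,
    fromℤ-injective (A 1F 0F) d₁ a₁₀≈c₁ ,
    fromℤ-injective (A 2F 1F) d₂ (trans a₂₁≈y (fromℤ-quotient d₁ d₂ (fromℤ-≉0 {d₁} (left-factor-≢0 d₁d₂≢0))))
    where
    entries : (fromℤ (A 2F 0F) ≈ 0#) × (fromℤ (A 1F 0F) ≈ fromℤ d₁) × (fromℤ (A 2F 1F) ≈ fromℤ (d₁ ℤ.* d₂) * fromℤ d₁ ⁻¹)
    entries = InΩw⇒lower-entries A A∈Ω
    a₂₀≈0 : fromℤ (A 2F 0F) ≈ 0#
    a₂₀≈0 = proj₁ entries
    a₁₀≈c₁ : fromℤ (A 1F 0F) ≈ fromℤ d₁
    a₁₀≈c₁ = proj₁ (proj₂ entries)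
    a₂₁≈y : fromℤ (A 2F 1F) ≈ fromℤ (d₁ ℤ.* d₂) * fromℤ d₁ ⁻¹
    a₂₁≈y = proj₂ (proj₂ entries)

  InBwB⇒InΩw-ℤ : ∀ A → InBwB-SL3Z A → InΩw-ℤ (A 1F 0F) (A 2F 1F) A
  InBwB⇒InΩw-ℤ A A∈BwB = a₁₀a₂₁≢0 , lower-entries⇒InΩw A (proj₁ A∈BwB) a₂₀≡0 ≡.refl ≡.refl a₁₀a₂₁≢0
    where
    a₂₀≡0 : A 2F 0F ≡ + 0
    a₂₀≡0 = proj₁ (InBwB⇒lower-entries A A∈BwB)
    a₁₀a₂₁≢0 : ¬ (A 1F 0F ℤ.* A 2F 1F ≡ + 0)
    a₁₀a₂₁≢0 = proj₂ (InBwB⇒lower-entries A A∈BwB)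

  InΩw-ℤ⇒InBwB : ∀ d₁ d₂ A → InΩw-ℤ d₁ d₂ A → InBwB-SL3Z A
  InΩw-ℤ⇒InBwB d₁ d₂ A (d₁d₂≢0 , A∈Ω) =
    InΩw⇒InBwB A (fromℤ-≉0 {d₁} (left-factor-≢0 d₁d₂≢0)) (fromℤ-≉0 {d₁ ℤ.* d₂} d₁d₂≢0) A∈Ω

  InΩw-ℤ⇒IαIβ-Decomposition : ∀ d₁ d₂ A → InΩw-ℤ d₁ d₂ A → IαIβ-Decomposition d₁ d₂ A
  InΩw-ℤ⇒IαIβ-Decomposition d₁ d₂ A A∈Ω =
    ≡.subst₂ (λ d₁ d₂ → IαIβ-Decomposition d₁ d₂ A) (proj₁ (proj₂ entries)) (proj₂ (proj₂ entries))
      (lower-zero⇒IαIβ-Decomposition A (proj₁ entries) (proj₁ (proj₂ A∈Ω)))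
    where
    entries : (A 2F 0F ≡ + 0) × (A 1F 0F ≡ d₁) × (A 2F 1F ≡ d₂)
    entries = InΩw-ℤ⇒lower-entries d₁ d₂ A A∈Ω

  InΩw-ℤ⇒InΓ₀ : ∀ N d₁ d₂ A → + N ∣ d₂ → InΩw-ℤ d₁ d₂ A → InΓ₀ N A
  InΩw-ℤ⇒InΓ₀ N d₁ d₂ A N∣d₂ A∈Ω =
    proj₁ (proj₂ A∈Ω) ,
    ≡.subst (+ N ∣_) (≡.sym (proj₁ entries)) (N ℕ∣.∣0) ,
    ≡.subst (+ N ∣_) (≡.sym (proj₂ (proj₂ entries))) N∣d₂
    where
    entries : (A 2F 0F ≡ + 0) × (A 1F 0F ≡ d₁) × (A 2F 1F ≡ d₂)
    entries = InΩw-ℤ⇒lower-entries d₁ d₂ A A∈Ω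

open import Data.Nat using (_≤_)
open import Data.Integer using (_*_)

proposition9p2 : ∀ {c ℓ : Level} (R : RealField c ℓ) → let open OverReals R in
    (∀ (A : MatZ) →
      (InBwB-SL3Z A → ∃ λ (d₁ : ℤ) → ∃ λ (d₂ : ℤ) → ¬ (d₁ * d₂ ≡ + 0) × InΩw (fromℤ d₁) (fromℤ (d₁ * d₂)) A)
      × ((∃ λ (d₁ : ℤ) → ∃ λ (d₂ : ℤ) → ¬ (d₁ * d₂ ≡ + 0) × InΩw (fromℤ d₁) (fromℤ (d₁ * d₂)) A) → InBwB-SL3Z A))
    × (∀ (d₁ d₂ : ℤ) → ¬ (d₁ * d₂ ≡ + 0) → ∀ (A : MatZ) → InΩw (fromℤ d₁) (fromℤ (d₁ * d₂)) A →
      ∃ λ (u : MatZ) → ∃ λ (u′ : MatZ) → InΓ∞ u × InΓ∞ u′ ×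
      ∃ λ (x₁ : ℤ) → ∃ λ (b₁ : ℤ) → ∃ λ (y₁ : ℤ) → ∃ λ (x₂ : ℤ) → ∃ λ (b₂ : ℤ) → ∃ λ (y₂ : ℤ) →
        InSL2Z x₁ b₁ d₁ y₁ × InSL2Z x₂ b₂ d₂ y₂ ×
        ((u ·Z A ·Z u′) ≡M (ια x₁ b₁ d₁ y₁ ·Z ιβ x₂ b₂ d₂ y₂)))
    × (∀ (N : ℕ) → 1 ≤ N → ∀ (A : MatZ) →
      ((InΓ₀ N A × InBwB-SL3Z A) → ∃ λ (d₁ : ℤ) → ∃ λ (d₂ : ℤ) → (+ N ∣ d₂) × ¬ (d₁ * d₂ ≡ + 0) × InΩw (fromℤ d₁) (fromℤ (d₁ * d₂)) A)
      × ((∃ λ (d₁ : ℤ) → ∃ λ (d₂ : ℤ) → (+ N ∣ d₂) × ¬ (d₁ * d₂ ≡ + 0) × InΩw (fromℤ d₁) (fromℤ (d₁ * d₂)) A) → (InΓ₀ N A × InBwB-SL3Z A)))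
proposition9p2 R =
  (λ A → (λ A∈BwB → A 1F 0F , A 2F 1F , InBwB⇒InΩw-ℤ A A∈BwB) ,
         (λ (d₁ , d₂ , A∈Ω) → InΩw-ℤ⇒InBwB d₁ d₂ A A∈Ω)) ,
  (λ d₁ d₂ d₁d₂≢0 A A∈Ω → InΩw-ℤ⇒IαIβ-Decomposition d₁ d₂ A (d₁d₂≢0 , A∈Ω)) ,
  (λ N _ A → (λ ((_ , _ , N∣a₂₁) , A∈BwB) → A 1F 0F , A 2F 1F , N∣a₂₁ , InBwB⇒InΩw-ℤ A A∈BwB) ,
             (λ (d₁ , d₂ , N∣d₂ , A∈Ω) → InΩw-ℤ⇒InΓ₀ N d₁ d₂ A N∣d₂ A∈Ω , InΩw-ℤ⇒InBwB d₁ d₂ A A∈Ω))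
  where open BruhatCells R
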